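{- Let $B$ and $C$ be finite nonempty sets of integers, let $m:=|B|$, and write $B=\{b_1,\dots,b_m\}$ with the elements numbered in an arbitrary order. Then there exist $c_2,\dots,c_m\in C$ such that the sums $b_2+c_2,\dots,b_m+c_m$ are pairwise distinct and none of them lies in the set $b_1+C$. -}

{-# OPTIONS --safe #-}
-- Pair every b > b₁ with max C and every b < b₁ with min C. The first kind of sum
-- then exceeds b₁ + max C and the second falls below b₁ + min C, so none lies in
-- b₁ + C; two sums of the same kind use the same summand and are separated by the
-- distinct b's, and sums of different kinds lie on opposite sides of b₁ + C.
module Submission where

open import Data.Nat using (ℕ; suc)
open import Data.Fin using (Fin; zero; suc)
open import Data.Fin.Properties using (0≢1+n; suc-injective)
open import Data.Integer using (ℤ; _+_; _≤_; _<_)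
open import Data.Integer.Properties
  using (≤-refl; ≤-trans; <-trans; ≤-<-trans; <-≤-trans; <⇒≢; ≤∧≢⇒<; ≮⇒≥; _<?_;
         +-monoˡ-<; +-monoʳ-≤; ≤-totalOrder; +-0-abelianGroup)
open import Data.List using (List; []; _∷_)
open import Data.List.Extrema ≤-totalOrder using (max; min; argmax-all; argmin-all; xs≤max; min≤xs; v≤max⁺; min≤⊤)
open import Data.List.Membership.Propositional using (_∈_)
open import Data.List.Relation.Unary.Any using (here; there)
open import Data.List.Relation.Unary.All using (lookup; tabulate)
open import Data.Product using (Σ; _×_; _,_)
open import Data.Sum using (inj₁)
open import Data.Empty using (⊥-elim)
open import Relation.Nullary using (yes; no; ¬_)
open import Relation.Binary.PropositionalEquality using (_≡_; _≢_; refl; sym)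
open import Function.Base using (id)
open import Function.Definitions using (Injective)
open import Algebra.Bundles using (AbelianGroup)
open import Algebra.Properties.Group (AbelianGroup.group +-0-abelianGroup) using (∙-cancelʳ)

max-∈ : ∀ x xs → max x xs ∈ x ∷ xs
max-∈ x xs = argmax-all id (here refl) (tabulate there)

min-∈ : ∀ x xs → min x xs ∈ x ∷ xs
min-∈ x xs = argmin-all id (here refl) (tabulate there)

∈⇒≤max : ∀ {v x xs} → v ∈ x ∷ xs → v ≤ max x xs
∈⇒≤max {xs = xs} (here refl) = v≤max⁺ _ xs (inj₁ ≤-refl)
∈⇒≤max {x = x} {xs} (there v∈xs) = lookup (xs≤max x xs) v∈xs

∈⇒min≤ : ∀ {v x xs} → v ∈ x ∷ xs → min x xs ≤ v
∈⇒min≤ {xs = xs} (here refl) = min≤⊤ _ xs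
∈⇒min≤ {x = x} {xs} (there v∈xs) = lookup (min≤xs x xs) v∈xs

≮∧≢⇒< : ∀ {p x} → ¬ p < x → x ≢ p → x < p
≮∧≢⇒< p≮x x≢p = ≤∧≢⇒< (≮⇒≥ p≮x) x≢p

+-straddle : ∀ {lo hi p x y} → lo ≤ hi → y < p → p < x → y + lo < x + hi
+-straddle {lo} {hi} {p} lo≤hi y<p p<x =
  <-trans (+-monoˡ-< lo y<p) (≤-<-trans (+-monoʳ-≤ p lo≤hi) (+-monoˡ-< hi p<x))

module Partner (p lo hi : ℤ) where

  partner : ℤ → ℤ
  partner x with p <? x
  ... | yes _ = hi
  ... | no  _ = lo

  partner-∈ : ∀ {C : List ℤ} x → lo ∈ C → hi ∈ C → partner x ∈ C
  partner-∈ x lo∈ hi∈ with p <? x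
  ... | yes _ = hi∈
  ... | no  _ = lo∈

  partner-sum-avoids : ∀ {x c} → x ≢ p → lo ≤ c → c ≤ hi → x + partner x ≢ p + c
  partner-sum-avoids {x} {c} x≢p lo≤c c≤hi with p <? x
  ... | yes p<x = λ eq → <⇒≢ (≤-<-trans (+-monoʳ-≤ p c≤hi) (+-monoˡ-< hi p<x)) (sym eq)
  ... | no  p≮x = <⇒≢ (<-≤-trans (+-monoˡ-< lo (≮∧≢⇒< p≮x x≢p)) (+-monoʳ-≤ p lo≤c))

  partner-sum-injective : lo ≤ hi → ∀ {x y} → x ≢ p → y ≢ p →
                          x + partner x ≡ y + partner y → x ≡ y
  partner-sum-injective lo≤hi {x} {y} x≢p y≢p eq with p <? x | p <? y
  ... | yes _   | yes _   = ∙-cancelʳ hi x y eq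
  ... | no  _   | no  _   = ∙-cancelʳ lo x y eq
  ... | yes p<x | no  p≮y = ⊥-elim (<⇒≢ (+-straddle lo≤hi (≮∧≢⇒< p≮y y≢p) p<x) (sym eq))
  ... | no  p≮x | yes p<y = ⊥-elim (<⇒≢ (+-straddle lo≤hi (≮∧≢⇒< p≮x x≢p) p<y) eq)

lemma5 : (k : ℕ) (b : Fin (suc k) → ℤ) → Injective _≡_ _≡_ b →
         (C : List ℤ) → C ≢ [] →
         Σ (Fin k → ℤ) (λ c →
           ((i : Fin k) → c i ∈ C) ×
           (Injective _≡_ _≡_ (λ i → b (suc i) + c i)) ×
           ((i : Fin k) (c′ : ℤ) → c′ ∈ C → b (suc i) + c i ≢ b zero + c′))
lemma5 k b b-inj [] C≢[] = ⊥-elim (C≢[] refl)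
lemma5 k b b-inj (x ∷ xs) _ =
  (λ i → partner (b (suc i))) ,
  (λ i → partner-∈ (b (suc i)) (min-∈ x xs) (max-∈ x xs)) ,
  (λ eq → suc-injective (b-inj (partner-sum-injective min≤max (b-suc≢b-zero _) (b-suc≢b-zero _) eq))) ,
  (λ i c′ c′∈C → partner-sum-avoids (b-suc≢b-zero i) (∈⇒min≤ c′∈C) (∈⇒≤max c′∈C))
  where
  open Partner (b zero) (min x xs) (max x xs)

  min≤max : min x xs ≤ max x xs
  min≤max = ≤-trans (min≤⊤ x xs) (v≤max⁺ x xs (inj₁ ≤-refl))

  b-suc≢b-zero : ∀ i → b (suc i) ≢ b zero
  b-suc≢b-zero i eq = 0≢1+n (sym (b-inj eq))
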